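{- Let $u\in T(\Sigma,X)$, $a,b\in\mathbb N$ and $\sigma,\mu,\sigma',\mu'\in S(\Sigma,X)$ with $\sigma'$ commuting with $\sigma$ and with $\mu$. Let $p=(u,(\sigma,\mu))$ and $q=(u\sigma^a,(\sigma^b\sigma',\mu\mu'))$. Then for every $n\in\mathbb N$ there exists $\eta\in S(\Sigma,X)$ such that $q(n)=p(a+n\times b)\eta$.
   Context: $\Sigma$ is a signature, $X$ an infinite countable set of variables, $T(\Sigma,X)$ the set of terms and $S(\Sigma,X)$ the set of substitutions (maps $X\to T(\Sigma,X)$ moving finitely many variables). Composition is $x(\sigma\theta)=(x\sigma)\theta$, $\emptyset$ is the identity, $\sigma^0=\emptyset$, $\sigma^{n+1}=\sigma^n\sigma$. $\sigma$ commutes with $\theta$ if $x\sigma\theta=x\theta\sigma$ for all $x\in X$. A pattern term is a pair $p=(s,(\sigma,\mu))$ with $s\in T(\Sigma,X)$ and $\sigma,\mu\in S(\Sigma,X)$; for $n\in\mathbb N$, $p(n)=s\sigma^n\mu$. -}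

module Defs where

open import Data.Nat using (ℕ; zero; suc; _≤_; _⊔_)
open import Data.Nat.Properties using (m⊔n≤o⇒m≤o; m⊔n≤o⇒n≤o)
open import Data.Vec using (Vec; []; _∷_)
open import Data.Product using (∃-syntax; _,_)
open import Relation.Binary.PropositionalEquality using (_≡_; refl; cong)

record Signature : Set₁ where
  field
    Sym   : Set
    arity : Sym → ℕ
open Signature public

Var : Set
Var = ℕ

data Term (Σ : Signature) : Set where
  var : Var → Term Σ
  fun : (f : Sym Σ) → Vec (Term Σ) (arity Σ f) → Term Σ

module _ {Σ : Signature} where
  mutual
    _⟪_⟫ : Term Σ → (Var → Term Σ) → Term Σ
    var x    ⟪ f ⟫ = f x
    fun g ts ⟪ f ⟫ = fun g (mapV ts f)

    mapV : ∀ {n} → Vec (Term Σ) n → (Var → Term Σ) → Vec (Term Σ) n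
    mapV []       f = []
    mapV (t ∷ ts) f = (t ⟪ f ⟫) ∷ mapV ts f

record Subst (Σ : Signature) : Set where
  constructor subst
  field
    apply  : Var → Term Σ
    finite : ∃[ N ] (∀ x → N ≤ x → apply x ≡ var x)
open Subst public

module _ {Σ : Signature} where
  _·_ : Term Σ → Subst Σ → Term Σ
  t · σ = t ⟪ apply σ ⟫

  ∅ : Subst Σ
  ∅ = subst var (0 , λ x _ → refl)

  _∘ₛ_ : Subst Σ → Subst Σ → Subst Σ
  σ ∘ₛ θ with finite σ | finite θ
  ... | (N , p) | (M , q) =
    subst (λ x → apply σ x ⟪ apply θ ⟫)
          (N ⊔ M , λ x le → aux x (p x (m⊔n≤o⇒m≤o N M le)) (q x (m⊔n≤o⇒n≤o N M le)))
    where
    aux : ∀ x → apply σ x ≡ var x → apply θ x ≡ var x → apply σ x ⟪ apply θ ⟫ ≡ var x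
    aux x e1 e2 rewrite e1 = e2

  _^ₛ_ : Subst Σ → ℕ → Subst Σ
  σ ^ₛ zero  = ∅
  σ ^ₛ suc n = (σ ^ₛ n) ∘ₛ σ

  Commute : Subst Σ → Subst Σ → Set
  Commute σ θ = ∀ x → (var x · σ) · θ ≡ (var x · θ) · σ

record PatternTerm (Σ : Signature) : Set where
  constructor pat
  field
    base : Term Σ
    iter : Subst Σ
    post : Subst Σ
open PatternTerm public

module _ {Σ : Signature} where
  _⟦_⟧ : PatternTerm Σ → ℕ → Term Σ
  p ⟦ n ⟧ = base p · ((iter p ^ₛ n) ∘ₛ post p)

-- Since σ′ commutes with σ, the power (σ^b σ′)^n acts as σ^(n b) σ′^n; and since σ′^n
-- commutes with μ it can be moved past μ. Hence
--   q(n) = u σ^a σ^(n b) σ′^n μ μ′ = (u σ^(a + n b) μ) σ′^n μ′ = p(a + n b) (σ′^n μ′).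
module Submission where

open import Defs
open import Data.Nat using (ℕ; zero; suc; _+_; _*_)
open import Data.Nat.Properties using (+-identityʳ; +-suc; +-comm)
open import Data.Vec using (Vec; []; _∷_)
open import Data.Product using (∃-syntax; _,_)
open import Relation.Binary.PropositionalEquality
  using (_≡_; refl; sym; trans; cong; cong₂; module ≡-Reasoning)

module _ {Σ : Signature} where

  mutual
    ⟪⟫-cong : (t : Term Σ) {f g : Var → Term Σ} → (∀ x → f x ≡ g x) → t ⟪ f ⟫ ≡ t ⟪ g ⟫
    ⟪⟫-cong (var x)    f≗g = f≗g x
    ⟪⟫-cong (fun h ts) f≗g = cong (fun h) (mapV-cong ts f≗g)

    mapV-cong : ∀ {n} (ts : Vec (Term Σ) n) {f g : Var → Term Σ} →
                (∀ x → f x ≡ g x) → mapV ts f ≡ mapV ts g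
    mapV-cong []       f≗g = refl
    mapV-cong (t ∷ ts) f≗g = cong₂ _∷_ (⟪⟫-cong t f≗g) (mapV-cong ts f≗g)

  mutual
    ⟪⟫-⟪⟫ : (t : Term Σ) (f g : Var → Term Σ) → t ⟪ f ⟫ ⟪ g ⟫ ≡ t ⟪ (λ x → f x ⟪ g ⟫) ⟫
    ⟪⟫-⟪⟫ (var x)    f g = refl
    ⟪⟫-⟪⟫ (fun h ts) f g = cong (fun h) (mapV-mapV ts f g)

    mapV-mapV : ∀ {n} (ts : Vec (Term Σ) n) (f g : Var → Term Σ) →
                mapV (mapV ts f) g ≡ mapV ts (λ x → f x ⟪ g ⟫)
    mapV-mapV []       f g = refl
    mapV-mapV (t ∷ ts) f g = cong₂ _∷_ (⟪⟫-⟪⟫ t f g) (mapV-mapV ts f g)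

  mutual
    ⟪var⟫ : (t : Term Σ) → t ⟪ var ⟫ ≡ t
    ⟪var⟫ (var x)    = refl
    ⟪var⟫ (fun h ts) = cong (fun h) (mapV-var ts)

    mapV-var : ∀ {n} (ts : Vec (Term Σ) n) → mapV ts var ≡ ts
    mapV-var []       = refl
    mapV-var (t ∷ ts) = cong₂ _∷_ (⟪var⟫ t) (mapV-var ts)

  ·-∅ : (t : Term Σ) → t · ∅ ≡ t
  ·-∅ = ⟪var⟫

  ·-∘ₛ : (t : Term Σ) (σ θ : Subst Σ) → t · (σ ∘ₛ θ) ≡ (t · σ) · θ
  ·-∘ₛ t σ θ = sym (⟪⟫-⟪⟫ t (apply σ) (apply θ))

  ·-^ₛ-+ : (t : Term Σ) (σ : Subst Σ) (m k : ℕ) →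
           t · (σ ^ₛ (m + k)) ≡ (t · (σ ^ₛ m)) · (σ ^ₛ k)
  ·-^ₛ-+ t σ m zero =
    trans (cong (λ i → t · (σ ^ₛ i)) (+-identityʳ m)) (sym (·-∅ (t · (σ ^ₛ m))))
  ·-^ₛ-+ t σ m (suc k) = begin
    t · (σ ^ₛ (m + suc k))          ≡⟨ cong (λ i → t · (σ ^ₛ i)) (+-suc m k) ⟩
    t · ((σ ^ₛ (m + k)) ∘ₛ σ)       ≡⟨ ·-∘ₛ t (σ ^ₛ (m + k)) σ ⟩
    (t · (σ ^ₛ (m + k))) · σ        ≡⟨ cong (_· σ) (·-^ₛ-+ t σ m k) ⟩
    ((t · (σ ^ₛ m)) · (σ ^ₛ k)) · σ ≡⟨ sym (·-∘ₛ (t · (σ ^ₛ m)) (σ ^ₛ k) σ) ⟩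
    (t · (σ ^ₛ m)) · (σ ^ₛ suc k)   ∎
    where open ≡-Reasoning

  ·-^ₛ-* : (t : Term Σ) (σ : Subst Σ) (n b : ℕ) → t · (σ ^ₛ (n * b)) ≡ t · ((σ ^ₛ b) ^ₛ n)
  ·-^ₛ-* t σ zero    b = refl
  ·-^ₛ-* t σ (suc n) b = begin
    t · (σ ^ₛ (b + n * b))              ≡⟨ cong (λ i → t · (σ ^ₛ i)) (+-comm b (n * b)) ⟩
    t · (σ ^ₛ (n * b + b))              ≡⟨ ·-^ₛ-+ t σ (n * b) b ⟩
    (t · (σ ^ₛ (n * b))) · (σ ^ₛ b)     ≡⟨ cong (_· (σ ^ₛ b)) (·-^ₛ-* t σ n b) ⟩
    (t · ((σ ^ₛ b) ^ₛ n)) · (σ ^ₛ b)    ≡⟨ sym (·-∘ₛ t ((σ ^ₛ b) ^ₛ n) (σ ^ₛ b)) ⟩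
    t · ((σ ^ₛ b) ^ₛ suc n)             ∎
    where open ≡-Reasoning

  ·-commute : (σ θ : Subst Σ) → Commute σ θ → (t : Term Σ) → (t · σ) · θ ≡ (t · θ) · σ
  ·-commute σ θ σθ t = begin
    (t · σ) · θ                         ≡⟨ ⟪⟫-⟪⟫ t (apply σ) (apply θ) ⟩
    t ⟪ (λ x → apply σ x ⟪ apply θ ⟫) ⟫ ≡⟨ ⟪⟫-cong t σθ ⟩
    t ⟪ (λ x → apply θ x ⟪ apply σ ⟫) ⟫ ≡⟨ sym (⟪⟫-⟪⟫ t (apply θ) (apply σ)) ⟩
    (t · θ) · σ                         ∎
    where open ≡-Reasoning

  Commute-sym : (σ θ : Subst Σ) → Commute σ θ → Commute θ σ
  Commute-sym σ θ σθ x = sym (σθ x)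

  Commute-^ʳ : (σ θ : Subst Σ) → Commute σ θ → (k : ℕ) → Commute σ (θ ^ₛ k)
  Commute-^ʳ σ θ σθ zero x = trans (·-∅ (var x · σ)) (cong (_· σ) (sym (·-∅ (var x))))
  Commute-^ʳ σ θ σθ (suc k) x = begin
    (t · σ) · ((θ ^ₛ k) ∘ₛ θ)   ≡⟨ ·-∘ₛ (t · σ) (θ ^ₛ k) θ ⟩
    ((t · σ) · (θ ^ₛ k)) · θ    ≡⟨ cong (_· θ) (Commute-^ʳ σ θ σθ k x) ⟩
    ((t · (θ ^ₛ k)) · σ) · θ    ≡⟨ ·-commute σ θ σθ (t · (θ ^ₛ k)) ⟩
    ((t · (θ ^ₛ k)) · θ) · σ    ≡⟨ cong (_· σ) (sym (·-∘ₛ t (θ ^ₛ k) θ)) ⟩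
    (t · ((θ ^ₛ k) ∘ₛ θ)) · σ   ∎
    where
    open ≡-Reasoning
    t : Term Σ
    t = var x

  ·-∘ₛ-^ₛ : (τ ρ : Subst Σ) → Commute τ ρ → (n : ℕ) (t : Term Σ) →
            t · ((τ ∘ₛ ρ) ^ₛ n) ≡ (t · (τ ^ₛ n)) · (ρ ^ₛ n)
  ·-∘ₛ-^ₛ τ ρ τρ zero t = trans (·-∅ t) (sym (trans (·-∅ (t · ∅)) (·-∅ t)))
  ·-∘ₛ-^ₛ τ ρ τρ (suc n) t = begin
    t · (((τ ∘ₛ ρ) ^ₛ n) ∘ₛ (τ ∘ₛ ρ))           ≡⟨ ·-∘ₛ t ((τ ∘ₛ ρ) ^ₛ n) (τ ∘ₛ ρ) ⟩
    (t · ((τ ∘ₛ ρ) ^ₛ n)) · (τ ∘ₛ ρ)            ≡⟨ ·-∘ₛ (t · ((τ ∘ₛ ρ) ^ₛ n)) τ ρ ⟩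
    ((t · ((τ ∘ₛ ρ) ^ₛ n)) · τ) · ρ             ≡⟨ cong (λ s → (s · τ) · ρ) (·-∘ₛ-^ₛ τ ρ τρ n t) ⟩
    (((t · (τ ^ₛ n)) · (ρ ^ₛ n)) · τ) · ρ       ≡⟨ cong (_· ρ) (sym (·-commute τ (ρ ^ₛ n) (Commute-^ʳ τ ρ τρ n) (t · (τ ^ₛ n)))) ⟩
    (((t · (τ ^ₛ n)) · τ) · (ρ ^ₛ n)) · ρ       ≡⟨ sym (·-∘ₛ ((t · (τ ^ₛ n)) · τ) (ρ ^ₛ n) ρ) ⟩
    ((t · (τ ^ₛ n)) · τ) · (ρ ^ₛ suc n)         ≡⟨ cong (_· (ρ ^ₛ suc n)) (sym (·-∘ₛ t (τ ^ₛ n) τ)) ⟩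
    (t · (τ ^ₛ suc n)) · (ρ ^ₛ suc n)           ∎
    where open ≡-Reasoning

lemmaA3 : {Σ : Signature} (u : Term Σ) (a b : ℕ) (σ μ σ′ μ′ : Subst Σ) →
          Commute σ′ σ → Commute σ′ μ →
          (n : ℕ) →
          ∃[ η ] (pat (u · (σ ^ₛ a)) ((σ ^ₛ b) ∘ₛ σ′) (μ ∘ₛ μ′) ⟦ n ⟧
                  ≡ (pat u σ μ ⟦ a + n * b ⟧) · η)
lemmaA3 u a b σ μ σ′ μ′ σ′σ σ′μ n = (σ′ ^ₛ n) ∘ₛ μ′ , (begin
  (u · (σ ^ₛ a)) · ((((σ ^ₛ b) ∘ₛ σ′) ^ₛ n) ∘ₛ (μ ∘ₛ μ′))
    ≡⟨ ·-∘ₛ (u · (σ ^ₛ a)) (((σ ^ₛ b) ∘ₛ σ′) ^ₛ n) (μ ∘ₛ μ′) ⟩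
  ((u · (σ ^ₛ a)) · (((σ ^ₛ b) ∘ₛ σ′) ^ₛ n)) · (μ ∘ₛ μ′)
    ≡⟨ cong (_· (μ ∘ₛ μ′)) (·-∘ₛ-^ₛ (σ ^ₛ b) σ′ (Commute-sym σ′ (σ ^ₛ b) (Commute-^ʳ σ′ σ σ′σ b)) n (u · (σ ^ₛ a))) ⟩
  (((u · (σ ^ₛ a)) · ((σ ^ₛ b) ^ₛ n)) · (σ′ ^ₛ n)) · (μ ∘ₛ μ′)
    ≡⟨ cong (λ s → (s · (σ′ ^ₛ n)) · (μ ∘ₛ μ′)) (sym (·-^ₛ-* (u · (σ ^ₛ a)) σ n b)) ⟩
  (((u · (σ ^ₛ a)) · (σ ^ₛ (n * b))) · (σ′ ^ₛ n)) · (μ ∘ₛ μ′)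
    ≡⟨ cong (λ s → (s · (σ′ ^ₛ n)) · (μ ∘ₛ μ′)) (sym (·-^ₛ-+ u σ a (n * b))) ⟩
  ((u · (σ ^ₛ (a + n * b))) · (σ′ ^ₛ n)) · (μ ∘ₛ μ′)
    ≡⟨ ·-∘ₛ ((u · (σ ^ₛ (a + n * b))) · (σ′ ^ₛ n)) μ μ′ ⟩
  (((u · (σ ^ₛ (a + n * b))) · (σ′ ^ₛ n)) · μ) · μ′
    ≡⟨ cong (_· μ′) (sym (·-commute μ (σ′ ^ₛ n) (Commute-^ʳ μ σ′ (Commute-sym σ′ μ σ′μ) n) (u · (σ ^ₛ (a + n * b))))) ⟩
  (((u · (σ ^ₛ (a + n * b))) · μ) · (σ′ ^ₛ n)) · μ′
    ≡⟨ cong (λ s → (s · (σ′ ^ₛ n)) · μ′) (sym (·-∘ₛ u (σ ^ₛ (a + n * b)) μ)) ⟩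
  ((u · ((σ ^ₛ (a + n * b)) ∘ₛ μ)) · (σ′ ^ₛ n)) · μ′
    ≡⟨ sym (·-∘ₛ (u · ((σ ^ₛ (a + n * b)) ∘ₛ μ)) (σ′ ^ₛ n) μ′) ⟩
  (u · ((σ ^ₛ (a + n * b)) ∘ₛ μ)) · ((σ′ ^ₛ n) ∘ₛ μ′)
    ∎)
  where open ≡-Reasoning
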